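{- Let $n\ge 3$. A three-element subset $S\subseteq D_n$ having exactly two of its elements in the cyclic subgroup $\langle r\rangle$ is a symmetric generating set of $D_n$ if and only if $S=\{x,y,z\}$ where $x^2=1$, $y$ and $z$ have order $n$, $yx=xz$, $yz=zy=1$, and $xy$ and $xz$ have order $2$. Moreover, $D_n$ has the presentation $\langle x,y,z\mid x^2=1,\ |y|=|z|=n,\ yx=xz,\ yz=zy=1,\ |xy|=|xz|=2\rangle$.
   Context: The dihedral group $D_n$ is the group of order $2n$ with presentation $\langle r,f\mid r^n=f^2=1,\ rf=fr^{ -1}\rangle$; its elements are $1,r,\dots,r^{n-1},f,rf,\dots,r^{n-1}f$, and $\langle r\rangle$ is its cyclic subgroup of order $n$. A subset $S$ of a group $G$ is a symmetric generating set if $S$ generates $G$, $1\notin S$, and $s\in S\Rightarrow s^{ -1}\in S$. $|g|$ denotes the order of $g$. -}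

module Defs where

open import Level using (Level)
open import Data.Nat using (ℕ; zero; suc; _+_; _∸_; _<_; NonZero)
open import Data.Nat.DivMod using (_mod_)
open import Data.Fin using (Fin; toℕ)
open import Data.Product using (_×_; Σ; ∃; ∃-syntax; _,_)
open import Data.Sum using (_⊎_)
open import Relation.Nullary using (¬_)
open import Relation.Binary.PropositionalEquality using (_≡_; _≢_)
open import Function.Bundles using (_⇔_)
open import Algebra.Bundles using (Group)

-- The dihedral group D_n (n ≥ 1), concretely:
--   rot k  represents  r^k
--   ref k  represents  r^k f
data D (n : ℕ) : Set where
  rot : Fin n → D n
  ref : Fin n → D n

module _ {n : ℕ} .{{_ : NonZero n}} where

  private
    add : Fin n → Fin n → Fin n
    add a b = (toℕ a + toℕ b) mod n
    sub : Fin n → Fin n → Fin n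
    sub a b = (toℕ a + (n ∸ toℕ b)) mod n

  -- multiplication, from r^n = f^2 = 1, r f = f r^{-1}
  infixl 7 _·_
  _·_ : D n → D n → D n
  rot a · rot b = rot (add a b)
  rot a · ref b = ref (add a b)
  ref a · rot b = ref (sub a b)   -- r^a f r^b = r^(a-b) f
  ref a · ref b = rot (sub a b)   -- r^a f r^b f = r^(a-b)

  e : D n
  e = rot (0 mod n)

  r : D n
  r = rot (1 mod n)

  f : D n
  f = ref (0 mod n)

  inv : D n → D n
  inv (rot a) = rot (sub (0 mod n) a)
  inv (ref a) = ref a

  pow : D n → ℕ → D n
  pow g zero = e
  pow g (suc k) = g · pow g k

  HasOrder : D n → ℕ → Set
  HasOrder g m = (0 < m) × (pow g m ≡ e) × (∀ k → 0 < k → k < m → pow g k ≢ e)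

  InCyclic : D n → Set
  InCyclic g = ∃[ k ] g ≡ pow r k

  data Gen (S : D n → Set) : D n → Set where
    gen-base : ∀ {g} → S g → Gen S g
    gen-one  : Gen S e
    gen-mul  : ∀ {g h} → Gen S g → Gen S h → Gen S (g · h)
    gen-inv  : ∀ {g} → Gen S g → Gen S (inv g)

  Generates : (D n → Set) → Set
  Generates S = ∀ g → Gen S g

  SymmetricGeneratingSet : (D n → Set) → Set
  SymmetricGeneratingSet S = Generates S × ¬ S e × (∀ s → S s → S (inv s))

⟦_,_,_⟧ : ∀ {A : Set} → A → A → A → A → Set
⟦ a , b , c ⟧ g = g ≡ a ⊎ g ≡ b ⊎ g ≡ c

_≐_ : ∀ {A : Set} → (A → Set) → (A → Set) → Set
S ≐ T = ∀ g → (S g ⇔ T g)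

ExactlyTwo : ∀ {A : Set} → (A → Set) → A → A → A → Set
ExactlyTwo P a b c =
  (P a × P b × ¬ P c) ⊎ (P a × ¬ P b × P c) ⊎ (¬ P a × P b × P c)

module _ {c ℓ : Level} (G : Group c ℓ) where
  open Group G
  gpow : Carrier → ℕ → Carrier
  gpow x zero = ε
  gpow x (suc k) = x ∙ gpow x k

  PresRelations : ℕ → Carrier → Carrier → Carrier → Set ℓ
  PresRelations n x y z =
    (x ∙ x ≈ ε) × (gpow y n ≈ ε) × (gpow z n ≈ ε) × (y ∙ x ≈ x ∙ z)
    × (y ∙ z ≈ ε) × (z ∙ y ≈ ε) × (gpow (x ∙ y) 2 ≈ ε) × (gpow (x ∙ z) 2 ≈ ε)

  IsHom : (n : ℕ) .{{_ : NonZero n}} → (D n → Carrier) → Set ℓ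
  IsHom n φ = ∀ g h → φ (g · h) ≈ φ g ∙ φ h

module Submission where

-- In D_n a rotation r^p
-- has order n exactly when p is a unit of ℤₙ (one direction via "an
-- injective endomap of Fin n is onto"), and r with any reflection generates.
-- The key lemma: for a subgroup H ≤ ℤₙ and an angle k, the rotations by H
-- together with the reflections r^a f, a ∈ k + H, contain everything
-- generated from inside them.  For a symmetric generating set
-- {r^k f, r^p, r^q} this forces q = -p (else all generators lie in the
-- 2-torsion version, which misses r when n ≥ 3) and p a unit (take H = ⟨p⟩),
-- so the relations hold; conversely the relations force exactly this shape.
-- Finally, elements x, y, z of any group satisfying the relations receive a
-- homomorphism D_n → G, r^a ↦ y^a, r^a f ↦ y^a x.  The theorem collects
-- these facts; its distinctness hypotheses turn out to be unnecessary.

open import Defs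
open import Level using (Level; 0ℓ)
open import Data.Nat using (ℕ; _≤_; NonZero)
open import Data.Product using (_×_; ∃-syntax)
open import Relation.Binary.PropositionalEquality using (_≡_; _≢_)
open import Function.Bundles using (_⇔_)
open import Algebra.Bundles using (Group)

open import Algebra.Bundles using (AbelianGroup)
open import Data.Nat using (zero; suc; _+_; _*_; _∸_; _<_; z≤n; s≤s; _%_; _/_; >-nonZero⁻¹)
open import Data.Nat.Properties
  using (+-comm; +-assoc; *-comm; <⇒≤; <-irrefl; ≤-trans; ≤-<-trans; m∸n≤m; m<n⇒0<n∸m; m+[n∸m]≡n; m∸n+n≡m; 1+n≰n)
open import Data.Nat.DivMod
  using (_mod_; m<n⇒m%n≡m; %-distribˡ-+; m%n%n≡m%n; n%n≡0; m≡m%n+[m/n]*n)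
open import Data.Fin using (Fin; toℕ)
open import Data.Fin.Base using (punchOut)
open import Data.Fin.Properties using (toℕ-injective; toℕ<n; toℕ-fromℕ<; punchOut-injective; injective⇒≤; any?)
  renaming (_≟_ to _≟ᶠ_; <-cmp to <-cmpᶠ)
open import Data.Product using (_,_; proj₁; proj₂)
open import Data.Sum using (_⊎_; inj₁; inj₂; swap; assocˡ; assocʳ; map₁)
open import Data.Empty using (⊥; ⊥-elim)
open import Relation.Nullary using (¬_; yes; no)
open import Relation.Binary.Definitions using (tri<; tri≈; tri>)
open import Relation.Binary.PropositionalEquality
  using (refl; sym; trans; cong; cong₂; subst; isEquivalence; module ≡-Reasoning)
open import Function.Base using (_∘_)
open import Function.Bundles using (mk⇔; Equivalence)
open import Function.Construct.Identity using (⇔-id)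
open import Function.Definitions using (Injective)

-- An injective endomap of a finite set is onto: a missed value y would let
-- the map be squeezed (by punching out y) injectively into a smaller set.
injective⇒onto : ∀ {m} (g : Fin m → Fin m) → Injective _≡_ _≡_ g → ∀ y → ∃[ i ] g i ≡ y
injective⇒onto {zero} g g-inj ()
injective⇒onto {suc m} g g-inj y with any? (λ i → g i ≟ᶠ y)
... | yes hit = hit
... | no missed = ⊥-elim (1+n≰n (injective⇒≤ squeezed-injective))
  where
  avoids-y : ∀ i → y ≢ g i
  avoids-y i eq = missed (i , sym eq)
  squeezed : Fin (suc m) → Fin m
  squeezed i = punchOut (avoids-y i)
  squeezed-injective : Injective _≡_ _≡_ squeezed
  squeezed-injective eq = g-inj (punchOut-injective (avoids-y _) (avoids-y _) eq)

⟦⟧-swap₁₂ : ∀ {A : Set} {a b c : A} → ⟦ a , b , c ⟧ ≐ ⟦ b , a , c ⟧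
⟦⟧-swap₁₂ _ = mk⇔ (assocʳ ∘ map₁ swap ∘ assocˡ) (assocʳ ∘ map₁ swap ∘ assocˡ)

⟦⟧-rotate : ∀ {A : Set} {a b c : A} → ⟦ a , b , c ⟧ ≐ ⟦ c , a , b ⟧
⟦⟧-rotate _ = mk⇔ (swap ∘ assocˡ) (assocʳ ∘ swap)

module _ {A : Set} (P : A → Set) {a b c : A} where

  exactly-two⇒not-all : ExactlyTwo P a b c → P a → P b → P c → ⊥
  exactly-two⇒not-all (inj₁ (_ , _ , ¬c)) _ _ pc = ¬c pc
  exactly-two⇒not-all (inj₂ (inj₁ (_ , ¬b , _))) _ pb _ = ¬b pb
  exactly-two⇒not-all (inj₂ (inj₂ (¬a , _ , _))) pa _ _ = ¬a pa

  exactly-two-¬first : ExactlyTwo P a b c → ¬ P a → P b × P c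
  exactly-two-¬first (inj₁ (pa , _ , _)) ¬a = ⊥-elim (¬a pa)
  exactly-two-¬first (inj₂ (inj₁ (pa , _ , _))) ¬a = ⊥-elim (¬a pa)
  exactly-two-¬first (inj₂ (inj₂ (_ , pb , pc))) _ = pb , pc

  exactly-two-¬second : ExactlyTwo P a b c → ¬ P b → P a × P c
  exactly-two-¬second (inj₁ (_ , pb , _)) ¬b = ⊥-elim (¬b pb)
  exactly-two-¬second (inj₂ (inj₁ (pa , _ , pc))) _ = pa , pc
  exactly-two-¬second (inj₂ (inj₂ (_ , pb , _))) ¬b = ⊥-elim (¬b pb)

-- The cyclic group ℤₙ on Fin n.  The operations are literally the index
-- arithmetic used by the multiplication of D n, so D n computes with them.
module ℤₙ {n : ℕ} .{{_ : NonZero n}} where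
  open ≡-Reasoning

  infixl 6 _⊕_ _⊟_
  infix 8 ⊖_

  _⊕_ : Fin n → Fin n → Fin n
  a ⊕ b = (toℕ a + toℕ b) mod n

  _⊟_ : Fin n → Fin n → Fin n
  a ⊟ b = (toℕ a + (n ∸ toℕ b)) mod n

  𝟘 : Fin n
  𝟘 = 0 mod n

  𝟙 : Fin n
  𝟙 = 1 mod n

  ⊖_ : Fin n → Fin n
  ⊖ a = 𝟘 ⊟ a

  toℕ-mod : ∀ m → toℕ (m mod n) ≡ m % n
  toℕ-mod m = toℕ-fromℕ< _

  toℕ-𝟘 : toℕ 𝟘 ≡ 0
  toℕ-𝟘 = trans (toℕ-mod 0) (m<n⇒m%n≡m (>-nonZero⁻¹ n))

  toℕ-𝟙 : 1 < n → toℕ 𝟙 ≡ 1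
  toℕ-𝟙 1<n = trans (toℕ-mod 1) (m<n⇒m%n≡m 1<n)

  toℕ-% : ∀ (a : Fin n) → toℕ a % n ≡ toℕ a
  toℕ-% a = m<n⇒m%n≡m (toℕ<n a)

  toℕ-⊖ : ∀ a → toℕ (⊖ a) ≡ (n ∸ toℕ a) % n
  toℕ-⊖ a = trans (toℕ-mod _) (cong (λ t → (t + (n ∸ toℕ a)) % n) toℕ-𝟘)

  %-absorbˡ : ∀ i j → (i % n + j) % n ≡ (i + j) % n
  %-absorbˡ i j = begin
    (i % n + j) % n           ≡⟨ %-distribˡ-+ (i % n) j n ⟩
    (i % n % n + j % n) % n   ≡⟨ cong (λ t → (t + j % n) % n) (m%n%n≡m%n i n) ⟩
    (i % n + j % n) % n       ≡⟨ %-distribˡ-+ i j n ⟨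
    (i + j) % n               ∎

  %-absorbʳ : ∀ i j → (i + j % n) % n ≡ (i + j) % n
  %-absorbʳ i j = begin
    (i + j % n) % n   ≡⟨ cong (_% n) (+-comm i (j % n)) ⟩
    (j % n + i) % n   ≡⟨ %-absorbˡ j i ⟩
    (j + i) % n       ≡⟨ cong (_% n) (+-comm j i) ⟩
    (i + j) % n       ∎

  ⊕-comm : ∀ a b → a ⊕ b ≡ b ⊕ a
  ⊕-comm a b = cong (_mod n) (+-comm (toℕ a) (toℕ b))

  ⊕-assoc : ∀ a b c → (a ⊕ b) ⊕ c ≡ a ⊕ (b ⊕ c)
  ⊕-assoc a b c = toℕ-injective (begin
    toℕ ((a ⊕ b) ⊕ c)                      ≡⟨ toℕ-mod _ ⟩
    (toℕ (a ⊕ b) + toℕ c) % n              ≡⟨ cong (λ t → (t + toℕ c) % n) (toℕ-mod _) ⟩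
    ((toℕ a + toℕ b) % n + toℕ c) % n      ≡⟨ %-absorbˡ (toℕ a + toℕ b) (toℕ c) ⟩
    (toℕ a + toℕ b + toℕ c) % n            ≡⟨ cong (_% n) (+-assoc (toℕ a) (toℕ b) (toℕ c)) ⟩
    (toℕ a + (toℕ b + toℕ c)) % n          ≡⟨ %-absorbʳ (toℕ a) (toℕ b + toℕ c) ⟨
    (toℕ a + (toℕ b + toℕ c) % n) % n      ≡⟨ cong (λ t → (toℕ a + t) % n) (toℕ-mod _) ⟨
    (toℕ a + toℕ (b ⊕ c)) % n              ≡⟨ toℕ-mod _ ⟨
    toℕ (a ⊕ (b ⊕ c))                      ∎)

  ⊕-identityˡ : ∀ a → 𝟘 ⊕ a ≡ a
  ⊕-identityˡ a = toℕ-injective (trans (toℕ-mod _) (trans (cong (λ t → (t + toℕ a) % n) toℕ-𝟘) (toℕ-% a)))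

  ⊕-identityʳ : ∀ a → a ⊕ 𝟘 ≡ a
  ⊕-identityʳ a = trans (⊕-comm a 𝟘) (⊕-identityˡ a)

  ⊖-inverseʳ : ∀ a → a ⊕ ⊖ a ≡ 𝟘
  ⊖-inverseʳ a = toℕ-injective (begin
    toℕ (a ⊕ ⊖ a)                    ≡⟨ toℕ-mod _ ⟩
    (toℕ a + toℕ (⊖ a)) % n          ≡⟨ cong (λ t → (toℕ a + t) % n) (toℕ-⊖ a) ⟩
    (toℕ a + (n ∸ toℕ a) % n) % n    ≡⟨ %-absorbʳ (toℕ a) (n ∸ toℕ a) ⟩
    (toℕ a + (n ∸ toℕ a)) % n        ≡⟨ cong (_% n) (m+[n∸m]≡n (<⇒≤ (toℕ<n a))) ⟩
    n % n                            ≡⟨ n%n≡0 n ⟩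
    0                                ≡⟨ toℕ-𝟘 ⟨
    toℕ 𝟘                            ∎)

  ⊖-inverseˡ : ∀ a → ⊖ a ⊕ a ≡ 𝟘
  ⊖-inverseˡ a = trans (⊕-comm (⊖ a) a) (⊖-inverseʳ a)

  ⊟-as-⊕ : ∀ a b → a ⊟ b ≡ a ⊕ ⊖ b
  ⊟-as-⊕ a b = toℕ-injective (begin
    toℕ (a ⊟ b)                        ≡⟨ toℕ-mod _ ⟩
    (toℕ a + (n ∸ toℕ b)) % n          ≡⟨ %-absorbʳ (toℕ a) (n ∸ toℕ b) ⟨
    (toℕ a + (n ∸ toℕ b) % n) % n      ≡⟨ cong (λ t → (toℕ a + t) % n) (toℕ-⊖ b) ⟨
    (toℕ a + toℕ (⊖ b)) % n            ≡⟨ toℕ-mod _ ⟨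
    toℕ (a ⊕ ⊖ b)                      ∎)

  ℤₙ-group : AbelianGroup 0ℓ 0ℓ
  ℤₙ-group = record
    { Carrier = Fin n ; _≈_ = _≡_ ; _∙_ = _⊕_ ; ε = 𝟘 ; _⁻¹ = ⊖_
    ; isAbelianGroup = record
      { isGroup = record
        { isMonoid = record
          { isSemigroup = record
            { isMagma = record { isEquivalence = isEquivalence ; ∙-cong = cong₂ _⊕_ }
            ; assoc = ⊕-assoc }
          ; identity = ⊕-identityˡ , ⊕-identityʳ }
        ; inverse = ⊖-inverseˡ , ⊖-inverseʳ
        ; ⁻¹-cong = cong ⊖_ }
      ; comm = ⊕-comm } }

  open import Algebra.Properties.AbelianGroup ℤₙ-group public
    using ()
    renaming ( ⁻¹-involutive to ⊖-involutive ; ⁻¹-injective to ⊖-injective ; ε⁻¹≈ε to ⊖𝟘≡𝟘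
             ; inverseʳ-unique to ⊖-unique ; ∙-cancelˡ to ⊕-cancelˡ ; ⁻¹-∙-comm to ⊖-⊕-distrib )
  open import Algebra.Properties.CommutativeSemigroup (AbelianGroup.commutativeSemigroup ℤₙ-group)
    using (interchange; xy∙z≈xz∙y)

  open import Algebra.Properties.CommutativeMonoid.Mult (AbelianGroup.commutativeMonoid ℤₙ-group) public
    using () renaming (_×_ to _⊛_ ; ×-homo-+ to ⊛-homo-+ ; ×-assocˡ to ⊛-assocˡ ; ×-distrib-+ to ⊛-distrib-⊕)

  ⊟-identityʳ : ∀ a → a ⊟ 𝟘 ≡ a
  ⊟-identityʳ a = trans (⊟-as-⊕ a 𝟘) (trans (cong (a ⊕_) ⊖𝟘≡𝟘) (⊕-identityʳ a))

  ⊟-self : ∀ a → a ⊟ a ≡ 𝟘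
  ⊟-self a = trans (⊟-as-⊕ a a) (⊖-inverseʳ a)

  ⊟-⊕-cancel : ∀ a b → (a ⊟ b) ⊕ b ≡ a
  ⊟-⊕-cancel a b = begin
    (a ⊟ b) ⊕ b        ≡⟨ cong (_⊕ b) (⊟-as-⊕ a b) ⟩
    (a ⊕ ⊖ b) ⊕ b      ≡⟨ ⊕-assoc a (⊖ b) b ⟩
    a ⊕ (⊖ b ⊕ b)      ≡⟨ cong (a ⊕_) (⊖-inverseˡ b) ⟩
    a ⊕ 𝟘              ≡⟨ ⊕-identityʳ a ⟩
    a                  ∎

  -- How the index of a reflection, measured relative to a base reflection
  -- k, transforms under the three kinds of products that yield reflections
  -- or rotations (rot·ref, ref·rot, ref·ref).
  shift-rot-ref : ∀ a b k → (a ⊕ b) ⊟ k ≡ a ⊕ (b ⊟ k)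
  shift-rot-ref a b k = begin
    (a ⊕ b) ⊟ k       ≡⟨ ⊟-as-⊕ (a ⊕ b) k ⟩
    (a ⊕ b) ⊕ ⊖ k     ≡⟨ ⊕-assoc a b (⊖ k) ⟩
    a ⊕ (b ⊕ ⊖ k)     ≡⟨ cong (a ⊕_) (⊟-as-⊕ b k) ⟨
    a ⊕ (b ⊟ k)       ∎

  shift-ref-rot : ∀ a b k → (a ⊟ b) ⊟ k ≡ (a ⊟ k) ⊕ ⊖ b
  shift-ref-rot a b k = begin
    (a ⊟ b) ⊟ k         ≡⟨ trans (⊟-as-⊕ (a ⊟ b) k) (cong (_⊕ ⊖ k) (⊟-as-⊕ a b)) ⟩
    (a ⊕ ⊖ b) ⊕ ⊖ k     ≡⟨ xy∙z≈xz∙y a (⊖ b) (⊖ k) ⟩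
    (a ⊕ ⊖ k) ⊕ ⊖ b     ≡⟨ cong (_⊕ ⊖ b) (⊟-as-⊕ a k) ⟨
    (a ⊟ k) ⊕ ⊖ b       ∎

  shift-ref-ref : ∀ a b k → a ⊟ b ≡ (a ⊟ k) ⊕ ⊖ (b ⊟ k)
  shift-ref-ref a b k = begin
    a ⊟ b                        ≡⟨ ⊟-as-⊕ a b ⟩
    a ⊕ ⊖ b                      ≡⟨ ⊕-identityʳ (a ⊕ ⊖ b) ⟨
    (a ⊕ ⊖ b) ⊕ 𝟘                ≡⟨ cong ((a ⊕ ⊖ b) ⊕_) (⊖-inverseˡ k) ⟨
    (a ⊕ ⊖ b) ⊕ (⊖ k ⊕ k)        ≡⟨ interchange a (⊖ b) (⊖ k) k ⟩
    (a ⊕ ⊖ k) ⊕ (⊖ b ⊕ k)        ≡⟨ cong₂ (λ s t → s ⊕ (⊖ b ⊕ t)) (⊟-as-⊕ a k) (⊖-involutive k) ⟨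
    (a ⊟ k) ⊕ (⊖ b ⊕ ⊖ ⊖ k)      ≡⟨ cong ((a ⊟ k) ⊕_) (⊖-⊕-distrib b (⊖ k)) ⟩
    (a ⊟ k) ⊕ ⊖ (b ⊕ ⊖ k)        ≡⟨ cong (λ t → (a ⊟ k) ⊕ ⊖ t) (⊟-as-⊕ b k) ⟨
    (a ⊟ k) ⊕ ⊖ (b ⊟ k)          ∎

  ⊛-𝟘 : ∀ k → k ⊛ 𝟘 ≡ 𝟘
  ⊛-𝟘 zero = refl
  ⊛-𝟘 (suc k) = trans (cong (𝟘 ⊕_) (⊛-𝟘 k)) (⊕-identityˡ 𝟘)

  ⊛-⊖ : ∀ k a → k ⊛ (⊖ a) ≡ ⊖ (k ⊛ a)
  ⊛-⊖ zero a = sym ⊖𝟘≡𝟘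
  ⊛-⊖ (suc k) a = trans (cong (⊖ a ⊕_) (⊛-⊖ k a)) (⊖-⊕-distrib a (k ⊛ a))

  ⊛-comm : ∀ i j a → i ⊛ (j ⊛ a) ≡ j ⊛ (i ⊛ a)
  ⊛-comm i j a = trans (⊛-assocˡ a i j) (trans (cong (_⊛ a) (*-comm i j)) (sym (⊛-assocˡ a j i)))

  toℕ-⊛𝟙 : ∀ k → toℕ (k ⊛ 𝟙) ≡ k % n
  toℕ-⊛𝟙 zero = trans toℕ-𝟘 (sym (m<n⇒m%n≡m (>-nonZero⁻¹ n)))
  toℕ-⊛𝟙 (suc k) = begin
    toℕ (𝟙 ⊕ k ⊛ 𝟙)              ≡⟨ toℕ-mod _ ⟩
    (toℕ 𝟙 + toℕ (k ⊛ 𝟙)) % n    ≡⟨ cong₂ (λ s t → (s + t) % n) (toℕ-mod 1) (toℕ-⊛𝟙 k) ⟩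
    (1 % n + k % n) % n          ≡⟨ %-distribˡ-+ 1 k n ⟨
    suc k % n                    ∎

  ⊛𝟙-toℕ : ∀ a → toℕ a ⊛ 𝟙 ≡ a
  ⊛𝟙-toℕ a = toℕ-injective (trans (toℕ-⊛𝟙 (toℕ a)) (toℕ-% a))

  ⊛𝟙≢𝟘 : ∀ {k} → 0 < k → k < n → k ⊛ 𝟙 ≢ 𝟘
  ⊛𝟙≢𝟘 {k} 0<k k<n k⊛𝟙≡𝟘 = <-irrefl (sym k≡0) 0<k
    where
    k≡0 : k ≡ 0
    k≡0 = begin
      k              ≡⟨ m<n⇒m%n≡m k<n ⟨
      k % n          ≡⟨ toℕ-⊛𝟙 k ⟨
      toℕ (k ⊛ 𝟙)    ≡⟨ cong toℕ k⊛𝟙≡𝟘 ⟩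
      toℕ 𝟘          ≡⟨ toℕ-𝟘 ⟩
      0              ∎

  n⊛ : ∀ a → n ⊛ a ≡ 𝟘
  n⊛ a = begin
    n ⊛ a               ≡⟨ cong (n ⊛_) (⊛𝟙-toℕ a) ⟨
    n ⊛ (toℕ a ⊛ 𝟙)     ≡⟨ ⊛-comm n (toℕ a) 𝟙 ⟩
    toℕ a ⊛ (n ⊛ 𝟙)     ≡⟨ cong (toℕ a ⊛_) n⊛𝟙 ⟩
    toℕ a ⊛ 𝟘           ≡⟨ ⊛-𝟘 (toℕ a) ⟩
    𝟘                   ∎
    where
    n⊛𝟙 : n ⊛ 𝟙 ≡ 𝟘
    n⊛𝟙 = toℕ-injective (trans (toℕ-⊛𝟙 n) (trans (n%n≡0 n) (sym toℕ-𝟘)))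

  -- H ⊆ ℤₙ is a subgroup (membership is automatically closed under ≡ via subst).
  record IsSubgroup (H : Fin n → Set) : Set where
    field
      contains-𝟘 : H 𝟘
      closed-⊕   : ∀ {a b} → H a → H b → H (a ⊕ b)
      closed-⊖   : ∀ {a} → H a → H (⊖ a)

  multiples : ∀ p → IsSubgroup (λ a → ∃[ j ] j ⊛ p ≡ a)
  multiples p = record
    { contains-𝟘 = 0 , refl
    ; closed-⊕   = λ { (i , refl) (j , refl) → i + j , ⊛-homo-+ p i j }
    ; closed-⊖   = λ { (i , refl) → i * (n ∸ 1) , neg-multiple i } }
    where
    -- -p = (n - 1) p, so -(i p) = (i (n - 1)) p
    n-1⊛p : (n ∸ 1) ⊛ p ≡ ⊖ p
    n-1⊛p = ⊖-unique p ((n ∸ 1) ⊛ p)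
      (trans (cong (_⊛ p) (m+[n∸m]≡n (>-nonZero⁻¹ n))) (n⊛ p))
    neg-multiple : ∀ i → (i * (n ∸ 1)) ⊛ p ≡ ⊖ (i ⊛ p)
    neg-multiple i = trans (sym (⊛-assocˡ p i (n ∸ 1)))
      (trans (cong (i ⊛_) n-1⊛p) (⊛-⊖ i p))

  torsion : ∀ k → IsSubgroup (λ a → k ⊛ a ≡ 𝟘)
  torsion k = record
    { contains-𝟘 = ⊛-𝟘 k
    ; closed-⊕   = λ {a} {b} ka kb → trans (⊛-distrib-⊕ a b k) (trans (cong₂ _⊕_ ka kb) (⊕-identityˡ 𝟘))
    ; closed-⊖   = λ {a} ka → trans (⊛-⊖ k a) (trans (cong ⊖_ ka) ⊖𝟘≡𝟘) }

  self-inverse⇒2-torsion : ∀ a → ⊖ a ≡ a → 2 ⊛ a ≡ 𝟘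
  self-inverse⇒2-torsion a ⊖a≡a = trans (cong (a ⊕_) (trans (⊕-identityʳ a) (sym ⊖a≡a))) (⊖-inverseʳ a)

module Dihedral {n : ℕ} .{{_ : NonZero n}} where
  open ℤₙ {n}
  open IsSubgroup
  open ≡-Reasoning

  rot-injective : ∀ {a b : Fin n} → rot a ≡ rot b → a ≡ b
  rot-injective refl = refl

  pow-rot : ∀ a k → pow (rot a) k ≡ rot (k ⊛ a)
  pow-rot a zero = refl
  pow-rot a (suc k) = cong (rot a ·_) (pow-rot a k)

  pow-r : ∀ a → pow r (toℕ a) ≡ rot a
  pow-r a = trans (pow-rot 𝟙 (toℕ a)) (cong rot (⊛𝟙-toℕ a))

  rotation⇒cyclic : ∀ a → InCyclic (rot a)
  rotation⇒cyclic a = toℕ a , sym (pow-r a)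

  reflection⇒not-cyclic : ∀ a → ¬ InCyclic (ref a)
  reflection⇒not-cyclic a (k , eq) with trans eq (pow-rot 𝟙 k)
  ... | ()

  pow-1 : ∀ g → pow g 1 ≡ g
  pow-1 (rot a) = cong rot (⊕-identityʳ a)
  pow-1 (ref a) = cong ref (⊟-identityʳ a)

  reflection-square : ∀ a → pow (ref a) 2 ≡ e
  reflection-square a = trans (cong (ref a ·_) (pow-1 (ref a))) (cong rot (⊟-self a))

  reflection-order-2 : ∀ a → HasOrder (ref a) 2
  reflection-order-2 a = s≤s z≤n , reflection-square a , minimal
    where
    minimal : ∀ k → 0 < k → k < 2 → pow (ref a) k ≢ e
    minimal (suc zero) _ _ ()
    minimal (suc (suc k)) _ (s≤s (s≤s ()))

  order-n⇒not-reflection : 3 ≤ n → ∀ a → ¬ HasOrder (ref a) n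
  order-n⇒not-reflection 3≤n a (_ , _ , minimal) = minimal 2 (s≤s z≤n) 3≤n (reflection-square a)

  order-n⇒not-identity : 3 ≤ n → ∀ g → HasOrder g n → g ≢ e
  order-n⇒not-identity 3≤n g (_ , _ , minimal) g≡e =
    minimal 1 (s≤s z≤n) (≤-trans (s≤s (s≤s z≤n)) 3≤n) (trans (pow-1 g) g≡e)

  unit⇒order-n : ∀ p j → j ⊛ p ≡ 𝟙 → HasOrder (rot p) n
  unit⇒order-n p j j⊛p≡𝟙 = >-nonZero⁻¹ n , trans (pow-rot p n) (cong rot (n⊛ p)) , minimal
    where
    minimal : ∀ k → 0 < k → k < n → pow (rot p) k ≢ e
    minimal k 0<k k<n pᵏ≡e = ⊛𝟙≢𝟘 0<k k<n (begin
      k ⊛ 𝟙            ≡⟨ cong (k ⊛_) j⊛p≡𝟙 ⟨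
      k ⊛ (j ⊛ p)      ≡⟨ ⊛-comm k j p ⟩
      j ⊛ (k ⊛ p)      ≡⟨ cong (j ⊛_) (rot-injective (trans (sym (pow-rot p k)) pᵏ≡e)) ⟩
      j ⊛ 𝟘            ≡⟨ ⊛-𝟘 j ⟩
      𝟘                ∎)

  -- Conversely, if r^p has order n then 0 ⊛ p, …, (n-1) ⊛ p are distinct,
  -- hence exhaust ℤₙ, and in particular 𝟙 is a multiple of p.
  multiples-differ : ∀ {p} → HasOrder (rot p) n → ∀ {i j} → i < j → j < n → i ⊛ p ≢ j ⊛ p
  multiples-differ {p} (_ , _ , minimal) {i} {j} i<j j<n i⊛p≡j⊛p =
    minimal (j ∸ i) (m<n⇒0<n∸m i<j) (≤-<-trans (m∸n≤m j i) j<n) (trans (pow-rot p (j ∸ i)) (cong rot gap))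
    where
    gap : (j ∸ i) ⊛ p ≡ 𝟘
    gap = sym (⊕-cancelˡ (i ⊛ p) 𝟘 ((j ∸ i) ⊛ p) (begin
      i ⊛ p ⊕ 𝟘                ≡⟨ ⊕-identityʳ (i ⊛ p) ⟩
      i ⊛ p                    ≡⟨ i⊛p≡j⊛p ⟩
      j ⊛ p                    ≡⟨ cong (_⊛ p) (m+[n∸m]≡n (<⇒≤ i<j)) ⟨
      (i + (j ∸ i)) ⊛ p        ≡⟨ ⊛-homo-+ p i (j ∸ i) ⟩
      i ⊛ p ⊕ (j ∸ i) ⊛ p      ∎))

  multiples-injective : ∀ {p} → HasOrder (rot p) n → Injective _≡_ _≡_ (λ (i : Fin n) → toℕ i ⊛ p)
  multiples-injective order {i} {j} eq with <-cmpᶠ i j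
  ... | tri< i<j _ _ = ⊥-elim (multiples-differ order i<j (toℕ<n j) eq)
  ... | tri≈ _ i≡j _ = i≡j
  ... | tri> _ _ j<i = ⊥-elim (multiples-differ order j<i (toℕ<n i) (sym eq))

  order-n⇒unit : ∀ p → HasOrder (rot p) n → ∃[ j ] j ⊛ p ≡ 𝟙
  order-n⇒unit p order with injective⇒onto (λ i → toℕ i ⊛ p) (multiples-injective order) 𝟙
  ... | i , i⊛p≡𝟙 = toℕ i , i⊛p≡𝟙

  order-n-⊖ : ∀ p → HasOrder (rot p) n → HasOrder (rot (⊖ p)) n
  order-n-⊖ p (0<n , _ , minimal) = 0<n , trans (pow-rot (⊖ p) n) (cong rot (n⊛ (⊖ p))) , minimal⁻
    where
    minimal⁻ : ∀ k → 0 < k → k < n → pow (rot (⊖ p)) k ≢ e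
    minimal⁻ k 0<k k<n p⁻ᵏ≡e = minimal k 0<k k<n (trans (pow-rot p k) (cong rot k⊛p≡𝟘))
      where
      ⊖k⊛p≡𝟘 : ⊖ (k ⊛ p) ≡ 𝟘
      ⊖k⊛p≡𝟘 = trans (sym (⊛-⊖ k p)) (rot-injective (trans (sym (pow-rot (⊖ p) k)) p⁻ᵏ≡e))
      k⊛p≡𝟘 : k ⊛ p ≡ 𝟘
      k⊛p≡𝟘 = ⊖-injective (trans ⊖k⊛p≡𝟘 (sym ⊖𝟘≡𝟘))

  gen-pow : ∀ {S g} → Gen S g → ∀ k → Gen S (pow g k)
  gen-pow g∈ zero = gen-one
  gen-pow g∈ (suc k) = gen-mul g∈ (gen-pow g∈ k)

  -- r and any reflection r^k f generate D_n: r^a f = r^(a-k) · r^k f.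
  reflection-and-r-generate : ∀ {S k} → Gen S (ref k) → Gen S r → Generates S
  reflection-and-r-generate {S} {k} ref∈ r∈ = generated
    where
    rotation : ∀ a → Gen S (rot a)
    rotation a = subst (Gen S) (pow-r a) (gen-pow r∈ (toℕ a))
    generated : Generates S
    generated (rot a) = rotation a
    generated (ref a) = subst (Gen S) (cong ref (⊟-⊕-cancel a k)) (gen-mul (rotation (a ⊟ k)) ref∈)

  -- For H ≤ ℤₙ, the rotations r^a (a ∈ H) and reflections r^a f (a ∈ k + H)
  -- form a subgroup of D_n; so it contains everything generated from within it.
  Lift : (Fin n → Set) → Fin n → D n → Set
  Lift H k (rot a) = H a
  Lift H k (ref a) = H (a ⊟ k)

  generated⊆lift : ∀ {H} → IsSubgroup H → ∀ k {S} → (∀ {g} → S g → Lift H k g) → ∀ {g} → Gen S g → Lift H k g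
  generated⊆lift {H} H≤ k {S} S⊆ = go
    where
    go : ∀ {g} → Gen S g → Lift H k g
    go (gen-base s) = S⊆ s
    go gen-one = contains-𝟘 H≤
    go (gen-mul {rot a} {rot b} g h) = closed-⊕ H≤ (go g) (go h)
    go (gen-mul {rot a} {ref b} g h) = subst H (sym (shift-rot-ref a b k)) (closed-⊕ H≤ (go g) (go h))
    go (gen-mul {ref a} {rot b} g h) = subst H (sym (shift-ref-rot a b k)) (closed-⊕ H≤ (go g) (closed-⊖ H≤ (go h)))
    go (gen-mul {ref a} {ref b} g h) = subst H (sym (shift-ref-ref a b k)) (closed-⊕ H≤ (go g) (closed-⊖ H≤ (go h)))
    go (gen-inv {rot a} g) = closed-⊖ H≤ (go g)
    go (gen-inv {ref a} g) = go g

  Relations : D n → D n → D n → Set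
  Relations x y z = (x · x ≡ e) × HasOrder y n × HasOrder z n × (y · x ≡ x · z)
    × (y · z ≡ e) × (z · y ≡ e) × HasOrder (x · y) 2 × HasOrder (x · z) 2

  Presented : (D n → Set) → Set
  Presented S = ∃[ x ] ∃[ y ] ∃[ z ] ((S ≐ ⟦ x , y , z ⟧) × Relations x y z)

  standard-relations : ∀ k p → HasOrder (rot p) n → Relations (ref k) (rot p) (rot (⊖ p))
  standard-relations k p order =
    cong rot (⊟-self k) , order , order-n-⊖ p order , cong ref yx≡xz ,
    cong rot (⊖-inverseʳ p) , cong rot (⊖-inverseˡ p) , reflection-order-2 _ , reflection-order-2 _
    where
    yx≡xz : p ⊕ k ≡ k ⊟ ⊖ p
    yx≡xz = begin
      p ⊕ k         ≡⟨ ⊕-comm p k ⟩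
      k ⊕ p         ≡⟨ cong (k ⊕_) (⊖-involutive p) ⟨
      k ⊕ ⊖ ⊖ p     ≡⟨ ⊟-as-⊕ k (⊖ p) ⟨
      k ⊟ ⊖ p       ∎

  module _ {S : D n → Set} {k p q : Fin n} (S≐ : S ≐ ⟦ ref k , rot p , rot q ⟧) where

    member : ∀ {g} → S g → g ≡ ref k ⊎ g ≡ rot p ⊎ g ≡ rot q
    member = Equivalence.to (S≐ _)

    ref-k∈ : S (ref k)
    ref-k∈ = Equivalence.from (S≐ _) (inj₁ refl)

    rot-p∈ : S (rot p)
    rot-p∈ = Equivalence.from (S≐ _) (inj₂ (inj₁ refl))

    rot-q∈ : S (rot q)
    rot-q∈ = Equivalence.from (S≐ _) (inj₂ (inj₂ refl))

    generating⇒𝟙∈ : Generates S → ∀ {H} → IsSubgroup H → H p → H q → H 𝟙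
    generating⇒𝟙∈ generates {H} H≤ Hp Hq = generated⊆lift H≤ k S⊆lift (generates r)
      where
      S⊆lift : ∀ {g} → S g → Lift H k g
      S⊆lift s with member s
      ... | inj₁ refl = subst H (sym (⊟-self k)) (contains-𝟘 H≤)
      ... | inj₂ (inj₁ refl) = Hp
      ... | inj₂ (inj₂ refl) = Hq

    -- If p and q were both self-inverse, 𝟙 would be 2-torsion, impossible for n ≥ 3.
    symmetric-generating⇒q≡⊖p : 3 ≤ n → Generates S → (∀ s → S s → S (inv s)) → q ≡ ⊖ p
    symmetric-generating⇒q≡⊖p 3≤n generates symmetric with member (symmetric _ rot-p∈)
    ... | inj₁ ()
    ... | inj₂ (inj₂ ⊖p≡q) = sym (rot-injective ⊖p≡q)
    ... | inj₂ (inj₁ ⊖p≡p) with member (symmetric _ rot-q∈)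
    ...   | inj₁ ()
    ...   | inj₂ (inj₁ ⊖q≡p) = trans (sym (⊖-involutive q)) (cong ⊖_ (rot-injective ⊖q≡p))
    ...   | inj₂ (inj₂ ⊖q≡q) = ⊥-elim (⊛𝟙≢𝟘 (s≤s z≤n) 3≤n
            (generating⇒𝟙∈ generates (torsion 2)
              (self-inverse⇒2-torsion p (rot-injective ⊖p≡p)) (self-inverse⇒2-torsion q (rot-injective ⊖q≡q))))

    generating⇒order-n : Generates S → q ≡ ⊖ p → HasOrder (rot p) n
    generating⇒order-n generates q≡⊖p with generating⇒𝟙∈ generates (multiples p) p∈⟨p⟩ q∈⟨p⟩
      where
      p∈⟨p⟩ : ∃[ j ] j ⊛ p ≡ p
      p∈⟨p⟩ = 1 , ⊕-identityʳ p
      q∈⟨p⟩ : ∃[ j ] j ⊛ p ≡ q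
      q∈⟨p⟩ = subst (λ t → ∃[ j ] j ⊛ p ≡ t) (sym q≡⊖p) (closed-⊖ (multiples p) p∈⟨p⟩)
    ... | j , j⊛p≡𝟙 = unit⇒order-n p j j⊛p≡𝟙

    symmetric-generating⇒presented : 3 ≤ n → SymmetricGeneratingSet S → Presented S
    symmetric-generating⇒presented 3≤n (generates , _ , symmetric) =
      ref k , rot p , rot q , S≐ ,
      subst (λ t → Relations (ref k) (rot p) (rot t)) (sym q≡⊖p)
        (standard-relations k p (generating⇒order-n generates q≡⊖p))
      where
      q≡⊖p : q ≡ ⊖ p
      q≡⊖p = symmetric-generating⇒q≡⊖p 3≤n generates symmetric

  -- Backward direction: a presented triple containing a reflection is
  -- {r^k f, r^u, r^(-u)} with |r^u| = n, hence a symmetric generating set.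
  presented⇒symmetric-generating : 3 ≤ n → ∀ {S k} → S (ref k) → Presented S → SymmetricGeneratingSet S
  presented⇒symmetric-generating 3≤n _ (_ , ref b , _ , _ , _ , y-order , _) =
    ⊥-elim (order-n⇒not-reflection 3≤n b y-order)
  presented⇒symmetric-generating 3≤n _ (_ , rot _ , ref b , _ , _ , _ , z-order , _) =
    ⊥-elim (order-n⇒not-reflection 3≤n b z-order)
  presented⇒symmetric-generating 3≤n {S} {k} ref-k∈ (x , rot u , rot w , S≐ , _ , u-order , w-order , _ , uw≡e , _) =
    generates , e∉S , symmetric
    where
    in-triple : ∀ {g} → S g → g ≡ x ⊎ g ≡ rot u ⊎ g ≡ rot w
    in-triple = Equivalence.to (S≐ _)
    rot-u∈ : S (rot u)
    rot-u∈ = Equivalence.from (S≐ _) (inj₂ (inj₁ refl))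
    rot-w∈ : S (rot w)
    rot-w∈ = Equivalence.from (S≐ _) (inj₂ (inj₂ refl))
    x≡ref-k : x ≡ ref k
    x≡ref-k with in-triple ref-k∈
    ... | inj₁ ref-k≡x = sym ref-k≡x
    ... | inj₂ (inj₁ ())
    ... | inj₂ (inj₂ ())
    w≡⊖u : w ≡ ⊖ u
    w≡⊖u = ⊖-unique u w (rot-injective uw≡e)
    generates : Generates S
    generates with order-n⇒unit u u-order
    ... | j , j⊛u≡𝟙 = reflection-and-r-generate (gen-base ref-k∈)
      (subst (Gen S) (trans (pow-rot u j) (cong rot j⊛u≡𝟙)) (gen-pow (gen-base rot-u∈) j))
    e∉S : ¬ S e
    e∉S e∈ with in-triple e∈
    ... | inj₁ e≡x with trans e≡x x≡ref-k
    ...   | ()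
    e∉S e∈ | inj₂ (inj₁ e≡y) = order-n⇒not-identity 3≤n (rot u) u-order (sym e≡y)
    e∉S e∈ | inj₂ (inj₂ e≡z) = order-n⇒not-identity 3≤n (rot w) w-order (sym e≡z)
    symmetric : ∀ s → S s → S (inv s)
    symmetric s s∈ with in-triple s∈
    ... | inj₁ refl = subst (S ∘ inv) (sym x≡ref-k) ref-k∈
    ... | inj₂ (inj₁ refl) = subst (S ∘ rot) w≡⊖u rot-w∈
    ... | inj₂ (inj₂ refl) = subst (S ∘ rot) (trans (sym (⊖-involutive u)) (cong ⊖_ (sym w≡⊖u))) rot-u∈

  classification : 3 ≤ n → ∀ {S k p q} → S ≐ ⟦ ref k , rot p , rot q ⟧ →
    SymmetricGeneratingSet S ⇔ Presented S
  classification 3≤n S≐ =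
    mk⇔ (symmetric-generating⇒presented S≐ 3≤n) (presented⇒symmetric-generating 3≤n (ref-k∈ S≐))

  one-reflection-two-rotations : ∀ a b c → ExactlyTwo InCyclic a b c →
    ∃[ k ] ∃[ p ] ∃[ q ] (⟦ a , b , c ⟧ ≐ ⟦ ref k , rot p , rot q ⟧)
  one-reflection-two-rotations (ref k) (rot p) (rot q) _ = k , p , q , λ g → ⇔-id _
  one-reflection-two-rotations (rot p) (ref k) (rot q) _ = k , p , q , ⟦⟧-swap₁₂
  one-reflection-two-rotations (rot p) (rot q) (ref k) _ = k , p , q , ⟦⟧-rotate
  one-reflection-two-rotations (rot a) (rot b) (rot c) two =
    ⊥-elim (exactly-two⇒not-all InCyclic two (rotation⇒cyclic a) (rotation⇒cyclic b) (rotation⇒cyclic c))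
  one-reflection-two-rotations (ref a) (ref b) _ two =
    ⊥-elim (reflection⇒not-cyclic b (proj₁ (exactly-two-¬first InCyclic two (reflection⇒not-cyclic a))))
  one-reflection-two-rotations (ref a) (rot _) (ref c) two =
    ⊥-elim (reflection⇒not-cyclic c (proj₂ (exactly-two-¬first InCyclic two (reflection⇒not-cyclic a))))
  one-reflection-two-rotations (rot _) (ref b) (ref c) two =
    ⊥-elim (reflection⇒not-cyclic c (proj₂ (exactly-two-¬second InCyclic two (reflection⇒not-cyclic b))))

module Powers {c ℓ : Level} (G : Group c ℓ) where
  open Group G renaming (refl to ≈-refl; sym to ≈-sym; trans to ≈-trans)
  open import Relation.Binary.Reasoning.Setoid setoid

  gpow-+ : ∀ u i j → gpow G u (i + j) ≈ gpow G u i ∙ gpow G u j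
  gpow-+ u zero j = ≈-sym (identityˡ _)
  gpow-+ u (suc i) j = ≈-trans (∙-congˡ (gpow-+ u i j)) (≈-sym (assoc u _ _))

  gpow-sucʳ : ∀ u b → gpow G u (suc b) ≈ gpow G u b ∙ u
  gpow-sucʳ u b = begin
    gpow G u (suc b)         ≡⟨ cong (gpow G u) (+-comm 1 b) ⟩
    gpow G u (b + 1)         ≈⟨ gpow-+ u b 1 ⟩
    gpow G u b ∙ (u ∙ ε)     ≈⟨ ∙-congˡ (identityʳ u) ⟩
    gpow G u b ∙ u           ∎

  module _ {n : ℕ} {u : Carrier} (uⁿ≈ε : gpow G u n ≈ ε) where

    gpow-multiple : ∀ q → gpow G u (q * n) ≈ ε
    gpow-multiple zero = ≈-refl
    gpow-multiple (suc q) = ≈-trans (gpow-+ u n (q * n)) (≈-trans (∙-cong uⁿ≈ε (gpow-multiple q)) (identityˡ ε))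

    gpow-% : .{{_ : NonZero n}} → ∀ t → gpow G u (t % n) ≈ gpow G u t
    gpow-% t = ≈-sym (begin
      gpow G u t                                 ≡⟨ cong (gpow G u) (m≡m%n+[m/n]*n t n) ⟩
      gpow G u (t % n + (t / n) * n)             ≈⟨ gpow-+ u (t % n) _ ⟩
      gpow G u (t % n) ∙ gpow G u ((t / n) * n)  ≈⟨ ∙-congˡ (gpow-multiple (t / n)) ⟩
      gpow G u (t % n) ∙ ε                       ≈⟨ identityʳ _ ⟩
      gpow G u (t % n)                           ∎)

    gpow-complement : ∀ {v} → u ∙ v ≈ ε → ∀ {b} → b ≤ n → gpow G v b ≈ gpow G u (n ∸ b)
    gpow-complement {v} uv≈ε {b} b≤n = ≈-sym (begin
      gpow G u (n ∸ b)                               ≈⟨ identityʳ _ ⟨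
      gpow G u (n ∸ b) ∙ ε                           ≈⟨ ∙-congˡ (inverse-powers b) ⟨
      gpow G u (n ∸ b) ∙ (gpow G u b ∙ gpow G v b)   ≈⟨ assoc _ _ _ ⟨
      (gpow G u (n ∸ b) ∙ gpow G u b) ∙ gpow G v b   ≈⟨ ∙-congʳ (gpow-+ u (n ∸ b) b) ⟨
      gpow G u (n ∸ b + b) ∙ gpow G v b              ≡⟨ cong (λ t → gpow G u t ∙ gpow G v b) (m∸n+n≡m b≤n) ⟩
      gpow G u n ∙ gpow G v b                        ≈⟨ ∙-congʳ uⁿ≈ε ⟩
      ε ∙ gpow G v b                                 ≈⟨ identityˡ _ ⟩
      gpow G v b                                     ∎)
      where
      inverse-powers : ∀ b → gpow G u b ∙ gpow G v b ≈ ε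
      inverse-powers zero = identityˡ ε
      inverse-powers (suc b) = begin
        (u ∙ gpow G u b) ∙ gpow G v (suc b)       ≈⟨ ∙-congˡ (gpow-sucʳ v b) ⟩
        (u ∙ gpow G u b) ∙ (gpow G v b ∙ v)       ≈⟨ assoc _ _ _ ⟩
        u ∙ (gpow G u b ∙ (gpow G v b ∙ v))       ≈⟨ ∙-congˡ (assoc _ _ _) ⟨
        u ∙ ((gpow G u b ∙ gpow G v b) ∙ v)       ≈⟨ ∙-congˡ (∙-congʳ (inverse-powers b)) ⟩
        u ∙ (ε ∙ v)                               ≈⟨ ∙-congˡ (identityˡ v) ⟩
        u ∙ v                                     ≈⟨ uv≈ε ⟩
        ε                                         ∎

  gpow-intertwine : ∀ {x u v} → x ∙ u ≈ v ∙ x → ∀ b → x ∙ gpow G u b ≈ gpow G v b ∙ x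
  gpow-intertwine {x} {u} {v} xu≈vx zero = ≈-trans (identityʳ x) (≈-sym (identityˡ x))
  gpow-intertwine {x} {u} {v} xu≈vx (suc b) = begin
    x ∙ (u ∙ gpow G u b)      ≈⟨ assoc x u _ ⟨
    (x ∙ u) ∙ gpow G u b      ≈⟨ ∙-congʳ xu≈vx ⟩
    (v ∙ x) ∙ gpow G u b      ≈⟨ assoc v x _ ⟩
    v ∙ (x ∙ gpow G u b)      ≈⟨ ∙-congˡ (gpow-intertwine xu≈vx b) ⟩
    v ∙ (gpow G v b ∙ x)      ≈⟨ assoc v _ x ⟨
    (v ∙ gpow G v b) ∙ x      ∎

module Presentation {c ℓ : Level} (G : Group c ℓ) {n : ℕ} .{{_ : NonZero n}} where
  open Group G renaming (refl to ≈-refl; sym to ≈-sym; trans to ≈-trans)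
  open import Relation.Binary.Reasoning.Setoid setoid
  open Powers G
  open ℤₙ {n}

  module Homomorphism {x y z : Carrier}
    (x²≈ε : x ∙ x ≈ ε) (yⁿ≈ε : gpow G y n ≈ ε) (yx≈xz : y ∙ x ≈ x ∙ z) (yz≈ε : y ∙ z ≈ ε) where

    ρ : Fin n → Carrier
    ρ a = gpow G y (toℕ a)

    φ : D n → Carrier
    φ (rot a) = ρ a
    φ (ref a) = ρ a ∙ x

    -- ρ is well defined on residues because yⁿ = 1.
    ρ-mod : ∀ m → ρ (m mod n) ≈ gpow G y m
    ρ-mod m = ≈-trans (reflexive (cong (gpow G y) (toℕ-mod m))) (gpow-% yⁿ≈ε m)

    ρ-⊕ : ∀ a b → ρ (a ⊕ b) ≈ ρ a ∙ ρ b
    ρ-⊕ a b = ≈-trans (ρ-mod (toℕ a + toℕ b)) (gpow-+ y (toℕ a) (toℕ b))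

    ρ-⊟ : ∀ a b → ρ (a ⊟ b) ≈ ρ a ∙ gpow G z (toℕ b)
    ρ-⊟ a b = begin
      ρ (a ⊟ b)                         ≈⟨ ρ-mod (toℕ a + (n ∸ toℕ b)) ⟩
      gpow G y (toℕ a + (n ∸ toℕ b))    ≈⟨ gpow-+ y (toℕ a) (n ∸ toℕ b) ⟩
      ρ a ∙ gpow G y (n ∸ toℕ b)        ≈⟨ ∙-congˡ (gpow-complement yⁿ≈ε yz≈ε (<⇒≤ (toℕ<n b))) ⟨
      ρ a ∙ gpow G z (toℕ b)            ∎

    -- conjugating yx = xz by x gives xy = zx
    xy≈zx : x ∙ y ≈ z ∙ x
    xy≈zx = begin
      x ∙ y                   ≈⟨ identityʳ _ ⟨
      (x ∙ y) ∙ ε             ≈⟨ ∙-congˡ x²≈ε ⟨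
      (x ∙ y) ∙ (x ∙ x)       ≈⟨ assoc x y _ ⟩
      x ∙ (y ∙ (x ∙ x))       ≈⟨ ∙-congˡ (assoc y x x) ⟨
      x ∙ ((y ∙ x) ∙ x)       ≈⟨ ∙-congˡ (∙-congʳ yx≈xz) ⟩
      x ∙ ((x ∙ z) ∙ x)       ≈⟨ ∙-congˡ (assoc x z x) ⟩
      x ∙ (x ∙ (z ∙ x))       ≈⟨ assoc x x _ ⟨
      (x ∙ x) ∙ (z ∙ x)       ≈⟨ ∙-congʳ x²≈ε ⟩
      ε ∙ (z ∙ x)             ≈⟨ identityˡ _ ⟩
      z ∙ x                   ∎

    φ-ref-rot : ∀ a b → ρ (a ⊟ b) ∙ x ≈ (ρ a ∙ x) ∙ ρ b
    φ-ref-rot a b = begin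
      ρ (a ⊟ b) ∙ x                  ≈⟨ ∙-congʳ (ρ-⊟ a b) ⟩
      (ρ a ∙ gpow G z (toℕ b)) ∙ x   ≈⟨ assoc _ _ _ ⟩
      ρ a ∙ (gpow G z (toℕ b) ∙ x)   ≈⟨ ∙-congˡ (gpow-intertwine xy≈zx (toℕ b)) ⟨
      ρ a ∙ (x ∙ ρ b)                ≈⟨ assoc _ _ _ ⟨
      (ρ a ∙ x) ∙ ρ b                ∎

    φ-hom : IsHom G n φ
    φ-hom (rot a) (rot b) = ρ-⊕ a b
    φ-hom (rot a) (ref b) = ≈-trans (∙-congʳ (ρ-⊕ a b)) (assoc _ _ _)
    φ-hom (ref a) (rot b) = φ-ref-rot a b
    φ-hom (ref a) (ref b) = begin
      ρ (a ⊟ b)                  ≈⟨ identityʳ _ ⟨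
      ρ (a ⊟ b) ∙ ε              ≈⟨ ∙-congˡ x²≈ε ⟨
      ρ (a ⊟ b) ∙ (x ∙ x)        ≈⟨ assoc _ x x ⟨
      (ρ (a ⊟ b) ∙ x) ∙ x        ≈⟨ ∙-congʳ (φ-ref-rot a b) ⟩
      ((ρ a ∙ x) ∙ ρ b) ∙ x      ≈⟨ assoc _ _ x ⟩
      (ρ a ∙ x) ∙ (ρ b ∙ x)      ∎

    ρ-𝟘 : ρ 𝟘 ≈ ε
    ρ-𝟘 = reflexive (cong (gpow G y) toℕ-𝟘)

    φ-f : φ f ≈ x
    φ-f = ≈-trans (∙-congʳ ρ-𝟘) (identityˡ x)

    φ-r : 1 < n → φ r ≈ y
    φ-r 1<n = ≈-trans (reflexive (cong (gpow G y) (toℕ-𝟙 1<n))) (identityʳ y)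

    φ-r⁻¹ : 1 < n → φ (inv r) ≈ z
    φ-r⁻¹ 1<n = begin
      ρ (𝟘 ⊟ 𝟙)                    ≈⟨ ρ-⊟ 𝟘 𝟙 ⟩
      ρ 𝟘 ∙ gpow G z (toℕ 𝟙)       ≈⟨ ∙-cong ρ-𝟘 (reflexive (cong (gpow G z) (toℕ-𝟙 1<n))) ⟩
      ε ∙ (z ∙ ε)                  ≈⟨ identityˡ _ ⟩
      z ∙ ε                        ≈⟨ identityʳ z ⟩
      z                            ∎

theorem3 : {c ℓ : Level} (n : ℕ) .{{_ : NonZero n}} → 3 ≤ n →
    ((a b c : D n) → a ≢ b → a ≢ c → b ≢ c → ExactlyTwo InCyclic a b c →
      (SymmetricGeneratingSet ⟦ a , b , c ⟧
        ⇔ (∃[ x ] ∃[ y ] ∃[ z ] ((⟦ a , b , c ⟧ ≐ ⟦ x , y , z ⟧)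
            × (x · x ≡ e) × HasOrder y n × HasOrder z n × (y · x ≡ x · z)
            × (y · z ≡ e) × (z · y ≡ e) × HasOrder (x · y) 2 × HasOrder (x · z) 2))))
    × (((f · f ≡ e) × HasOrder r n × HasOrder (inv r) n × (r · f ≡ f · inv r)
        × (r · inv r ≡ e) × (inv r · r ≡ e) × HasOrder (f · r) 2 × HasOrder (f · inv r) 2)
      × Generates ⟦ f , r , inv r ⟧
      × ((G : Group c ℓ) (x y z : Group.Carrier G) → PresRelations G n x y z →
          ∃[ φ ] (IsHom G n φ × Group._≈_ G (φ f) x × Group._≈_ G (φ r) y
                  × Group._≈_ G (φ (inv r)) z)))
theorem3 n 3≤n =
    (λ a b c _ _ _ two →
      let (_ , _ , _ , abc≐) = one-reflection-two-rotations a b c two in classification 3≤n abc≐)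
  , standard-relations 𝟘 𝟙 (unit⇒order-n 𝟙 1 (⊕-identityʳ 𝟙))
  , reflection-and-r-generate (gen-base (inj₁ refl)) (gen-base (inj₂ (inj₁ refl)))
  , λ { G x y z (x²≈ε , yⁿ≈ε , _ , yx≈xz , yz≈ε , _) →
        let open Presentation.Homomorphism G {n} x²≈ε yⁿ≈ε yx≈xz yz≈ε
        in φ , φ-hom , φ-f , φ-r 1<n , φ-r⁻¹ 1<n }
  where
  open ℤₙ {n}
  open Dihedral {n}
  1<n : 1 < n
  1<n = ≤-trans (s≤s (s≤s z≤n)) 3≤n
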